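{- For $r\ge1$ let $Q_r=(q_{ij})$ be the $r\times r$ integer matrix with $q_{ii}=2$, $q_{ij}=1$ for $i<j$, $q_{i+1,i}=-1$, and all other entries $0$. Then $\det Q_r=F_{2r+1}$.
   Context: $F_m$ denotes the Fibonacci numbers: $F_1=F_2=1$, $F_{m+1}=F_m+F_{m-1}$. -}

module Defs where

open import Data.Nat using (ℕ; zero; suc)
open import Data.Integer using (ℤ; +_; -_; _+_; _*_; -1ℤ; 0ℤ; 1ℤ)
open import Data.Fin using (Fin; zero; suc; toℕ; punchIn)
open import Data.Nat using (_<ᵇ_; _≡ᵇ_)
open import Data.Bool using (if_then_else_)

fib : ℕ → ℕ
fib zero = zero
fib (suc zero) = suc zero
fib (suc (suc m)) = fib (suc m) Data.Nat.+ fib m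

-- Square matrices over ℤ, as functions (row index, column index).
Matrix : ℕ → Set
Matrix n = Fin n → Fin n → ℤ

minor : ∀ {n} → Matrix (suc n) → Fin (suc n) → Matrix n
minor A j r c = A (suc r) (punchIn j c)

sign : ℕ → ℤ
sign zero = 1ℤ
sign (suc k) = - sign k

sumFin : ∀ n → (Fin n → ℤ) → ℤ
sumFin zero f = 0ℤ
sumFin (suc n) f = f zero + sumFin n (λ i → f (suc i))

det : ∀ n → Matrix n → ℤ
det zero A = 1ℤ
det (suc n) A = sumFin (suc n) (λ j → sign (toℕ j) * (A zero j * det n (minor A j)))

Q : (r : ℕ) → Matrix r
Q r i j =
  if toℕ i ≡ᵇ toℕ j then + 2
  else if toℕ i <ᵇ toℕ j then + 1
  else if toℕ i ≡ᵇ suc (toℕ j) then -1ℤ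
  else 0ℤ

module Submission where

-- Write D n = det (Q n).  Expanding along the first row (which is 2, 1, 1, …, 1),
-- the minor obtained by deleting column 0 is Q (n-1) itself, while the minor for
-- column j ≥ 1 has first column (-1, 0, …, 0)ᵀ; expanding it along that column
-- repeatedly gives (-1)^j D (n-1-j).  The signs cancel against the Laplace signs,
-- so
--     D (n+1) = 2 D n + Σ_{i<n} D (n-1-i).
-- The Fibonacci numbers F_{2n+1} satisfy the same recurrence, because the odd
-- Fibonacci numbers sum to an even one: Σ_{i<n} F_{2i+1} = F_{2n}, and
-- F_{2n+3} = 2 F_{2n+1} + F_{2n}.

open import Defs
open import Data.Nat using (ℕ; zero; suc; _≥_; _+_; _*_; _∸_; _<_; s≤s)
open import Data.Nat.Properties using (+-comm; +-suc; ≤-refl; m∸n≤m)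
open import Data.Nat.Induction using (<-rec)
open import Data.Integer using (ℤ; +_; -_; -1ℤ; 0ℤ; 1ℤ)
  renaming (_+_ to _+ℤ_; _*_ to _*ℤ_)
open import Data.Integer.Properties using (*-identityˡ; *-zeroʳ; +-identityʳ; pos-+; pos-*)
open import Data.Fin using (Fin; zero; suc; toℕ)
open import Relation.Binary.PropositionalEquality
  using (_≡_; refl; sym; trans; cong; cong₂; module ≡-Reasoning)
import Data.Integer.Tactic.RingSolver as ℤ-Ring
import Data.Nat.Tactic.RingSolver as ℕ-Ring

sumFin-cong : ∀ n {f g : Fin n → ℤ} → (∀ i → f i ≡ g i) → sumFin n f ≡ sumFin n g
sumFin-cong zero    f≡g = refl
sumFin-cong (suc n) f≡g = cong₂ _+ℤ_ (f≡g zero) (sumFin-cong n (λ i → f≡g (suc i)))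

sumFin-zero : ∀ n {f : Fin n → ℤ} → (∀ i → f i ≡ 0ℤ) → sumFin n f ≡ 0ℤ
sumFin-zero zero    f≡0 = refl
sumFin-zero (suc n) f≡0 = cong₂ _+ℤ_ (f≡0 zero) (sumFin-zero n (λ i → f≡0 (suc i)))

ZeroBelowCorner : ∀ {n} → Matrix (suc n) → Set
ZeroBelowCorner A = ∀ r → A (suc r) zero ≡ 0ℤ

laplaceTail : ∀ n → Matrix (suc n) → ℤ
laplaceTail n A = sumFin n (λ i → sign (toℕ (suc i)) *ℤ (A zero (suc i) *ℤ det n (minor A (suc i))))

det-suc : ∀ n (A : Matrix (suc n)) →
          det (suc n) A ≡ A zero zero *ℤ det n (minor A zero) +ℤ laplaceTail n A
det-suc n A = cong (_+ℤ laplaceTail n A) (*-identityˡ (A zero zero *ℤ det n (minor A zero)))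

-- If the first column vanishes below the corner, every minor other than the
-- corner one has an entirely zero first column, so the tail of the expansion is 0;
-- and a matrix whose whole first column is zero has determinant 0.
laplaceTail-vanishes : ∀ n (A : Matrix (suc n)) → ZeroBelowCorner A → laplaceTail n A ≡ 0ℤ
det-zeroColumn : ∀ n (B : Matrix (suc n)) → (∀ r → B r zero ≡ 0ℤ) → det (suc n) B ≡ 0ℤ

laplaceTail-vanishes zero    A A↓≡0 = refl
laplaceTail-vanishes (suc n) A A↓≡0 = sumFin-zero (suc n) λ i → begin
    sign (toℕ (suc i)) *ℤ (A zero (suc i) *ℤ det (suc n) (minor A (suc i)))
  ≡⟨ cong (λ d → sign (toℕ (suc i)) *ℤ (A zero (suc i) *ℤ d))
          (det-zeroColumn n (minor A (suc i)) A↓≡0) ⟩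
    sign (toℕ (suc i)) *ℤ (A zero (suc i) *ℤ 0ℤ)
  ≡⟨ cong (sign (toℕ (suc i)) *ℤ_) (*-zeroʳ (A zero (suc i))) ⟩
    sign (toℕ (suc i)) *ℤ 0ℤ
  ≡⟨ *-zeroʳ (sign (toℕ (suc i))) ⟩
    0ℤ
  ∎
  where open ≡-Reasoning

det-zeroColumn n B B↓≡0 = begin
    det (suc n) B
  ≡⟨ det-suc n B ⟩
    B zero zero *ℤ det n (minor B zero) +ℤ laplaceTail n B
  ≡⟨ cong₂ _+ℤ_ (cong (_*ℤ det n (minor B zero)) (B↓≡0 zero))
                (laplaceTail-vanishes n B (λ r → B↓≡0 (suc r))) ⟩
    0ℤ
  ∎
  where open ≡-Reasoning

det-zeroBelowCorner : ∀ n (A : Matrix (suc n)) → ZeroBelowCorner A →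
                      det (suc n) A ≡ A zero zero *ℤ det n (minor A zero)
det-zeroBelowCorner n A A↓≡0 = begin
    det (suc n) A
  ≡⟨ det-suc n A ⟩
    A zero zero *ℤ det n (minor A zero) +ℤ laplaceTail n A
  ≡⟨ cong (A zero zero *ℤ det n (minor A zero) +ℤ_) (laplaceTail-vanishes n A A↓≡0) ⟩
    A zero zero *ℤ det n (minor A zero) +ℤ 0ℤ
  ≡⟨ +-identityʳ _ ⟩
    A zero zero *ℤ det n (minor A zero)
  ∎
  where open ≡-Reasoning

sign-cancel : ∀ k y → sign k *ℤ (sign k *ℤ y) ≡ y
sign-cancel zero    y = trans (*-identityˡ _) (*-identityˡ y)
sign-cancel (suc k) y = trans (neg-neg (sign k) y) (sign-cancel k y)
  where
  neg-neg : ∀ s y → (- s) *ℤ ((- s) *ℤ y) ≡ s *ℤ (s *ℤ y)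
  neg-neg = ℤ-Ring.solve-∀

D : ℕ → ℤ
D n = det n (Q n)

-- For j = 0 the minor is Q n itself (definitionally); for j ≥ 1
-- its first column is (-1, 0, …, 0)ᵀ and its corner minor is the j-1 minor of Q n.
det-minorQ : ∀ n (j : Fin (suc n)) → det n (minor (Q (suc n)) j) ≡ sign (toℕ j) *ℤ D (n ∸ toℕ j)
det-minorQ n       zero    = sym (*-identityˡ (D n))
det-minorQ (suc n) (suc j) = begin
    det (suc n) (minor (Q (suc (suc n))) (suc j))
  ≡⟨ det-zeroBelowCorner n (minor (Q (suc (suc n))) (suc j)) (λ r → refl) ⟩
    -1ℤ *ℤ det n (minor (Q (suc n)) j)
  ≡⟨ cong (-1ℤ *ℤ_) (det-minorQ n j) ⟩
    -1ℤ *ℤ (sign (toℕ j) *ℤ D (n ∸ toℕ j))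
  ≡⟨ assoc-neg (sign (toℕ j)) (D (n ∸ toℕ j)) ⟩
    sign (suc (toℕ j)) *ℤ D (n ∸ toℕ j)
  ∎
  where
  open ≡-Reasoning
  assoc-neg : ∀ s d → -1ℤ *ℤ (s *ℤ d) ≡ (- s) *ℤ d
  assoc-neg = ℤ-Ring.solve-∀

D-recurrence : ∀ n → D (suc n) ≡ + 2 *ℤ D n +ℤ sumFin n (λ i → D (n ∸ suc (toℕ i)))
D-recurrence n = begin
    D (suc n)
  ≡⟨ det-suc n (Q (suc n)) ⟩
    + 2 *ℤ D n +ℤ laplaceTail n (Q (suc n))
  ≡⟨ cong (+ 2 *ℤ D n +ℤ_) (sumFin-cong n tail-term) ⟩
    + 2 *ℤ D n +ℤ sumFin n (λ i → D (n ∸ suc (toℕ i)))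
  ∎
  where
  open ≡-Reasoning
  -- The first-row entry is 1 and the minor's sign cancels the Laplace sign.
  tail-term : ∀ i → sign (suc (toℕ i)) *ℤ (1ℤ *ℤ det n (minor (Q (suc n)) (suc i)))
                    ≡ D (n ∸ suc (toℕ i))
  tail-term i = begin
      sign (suc (toℕ i)) *ℤ (1ℤ *ℤ det n (minor (Q (suc n)) (suc i)))
    ≡⟨ cong (sign (suc (toℕ i)) *ℤ_) (*-identityˡ _) ⟩
      sign (suc (toℕ i)) *ℤ det n (minor (Q (suc n)) (suc i))
    ≡⟨ cong (sign (suc (toℕ i)) *ℤ_) (det-minorQ n (suc i)) ⟩
      sign (suc (toℕ i)) *ℤ (sign (suc (toℕ i)) *ℤ D (n ∸ suc (toℕ i)))
    ≡⟨ sign-cancel (suc (toℕ i)) _ ⟩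
      D (n ∸ suc (toℕ i))
    ∎

odd-index : ∀ k → 2 * k + 1 ≡ suc (2 * k)
odd-index k = +-comm (2 * k) 1

double-suc : ∀ k → 2 * suc k ≡ suc (suc (2 * k))
double-suc k = cong suc (+-suc k (k + 0))

-- The odd Fibonacci numbers below 2n sum to F_{2n} (summed in reverse order, as
-- they occur in the recurrence for D).
fib-odd-sum : ∀ n → sumFin n (λ i → + fib (2 * (n ∸ suc (toℕ i)) + 1)) ≡ + fib (2 * n)
fib-odd-sum zero    = refl
fib-odd-sum (suc n) = begin
    + fib (2 * n + 1) +ℤ sumFin n (λ i → + fib (2 * (n ∸ suc (toℕ i)) + 1))
  ≡⟨ cong (+ fib (2 * n + 1) +ℤ_) (fib-odd-sum n) ⟩
    + fib (2 * n + 1) +ℤ + fib (2 * n)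
  ≡⟨ sym (pos-+ (fib (2 * n + 1)) (fib (2 * n))) ⟩
    + (fib (2 * n + 1) + fib (2 * n))
  ≡⟨ cong (λ m → + (fib m + fib (2 * n))) (odd-index n) ⟩
    + fib (suc (suc (2 * n)))
  ≡⟨ cong (λ m → + fib m) (sym (double-suc n)) ⟩
    + fib (2 * suc n)
  ∎
  where open ≡-Reasoning

fib-odd-step : ∀ k → 2 * fib (2 * k + 1) + fib (2 * k) ≡ fib (2 * suc k + 1)
fib-odd-step k = begin
    2 * fib (2 * k + 1) + fib (2 * k)
  ≡⟨ cong (λ m → 2 * fib m + fib (2 * k)) (odd-index k) ⟩
    2 * fib (suc (2 * k)) + fib (2 * k)
  ≡⟨ twice (fib (suc (2 * k))) (fib (2 * k)) ⟩
    fib (suc (suc (suc (2 * k))))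
  ≡⟨ cong fib (sym (trans (odd-index (suc k)) (cong suc (double-suc k)))) ⟩
    fib (2 * suc k + 1)
  ∎
  where
  open ≡-Reasoning
  twice : ∀ a b → 2 * a + b ≡ (a + b) + a
  twice = ℕ-Ring.solve-∀

D≡fib : ∀ n → D n ≡ + fib (2 * n + 1)
D≡fib = <-rec (λ n → D n ≡ + fib (2 * n + 1)) step
  where
  open ≡-Reasoning
  step : ∀ n → (∀ {m} → m < n → D m ≡ + fib (2 * m + 1)) → D n ≡ + fib (2 * n + 1)
  step zero    _  = refl
  step (suc n) ih = begin
      D (suc n)
    ≡⟨ D-recurrence n ⟩
      + 2 *ℤ D n +ℤ sumFin n (λ i → D (n ∸ suc (toℕ i)))
    ≡⟨ cong₂ (λ d s → + 2 *ℤ d +ℤ s) (ih ≤-refl)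
             (sumFin-cong n (λ i → ih (s≤s (m∸n≤m n (suc (toℕ i)))))) ⟩
      + 2 *ℤ + fib (2 * n + 1) +ℤ sumFin n (λ i → + fib (2 * (n ∸ suc (toℕ i)) + 1))
    ≡⟨ cong₂ _+ℤ_ (sym (pos-* 2 (fib (2 * n + 1)))) (fib-odd-sum n) ⟩
      + (2 * fib (2 * n + 1)) +ℤ + fib (2 * n)
    ≡⟨ sym (pos-+ (2 * fib (2 * n + 1)) (fib (2 * n))) ⟩
      + (2 * fib (2 * n + 1) + fib (2 * n))
    ≡⟨ cong +_ (fib-odd-step n) ⟩
      + fib (2 * suc n + 1)
    ∎

-- The theorem; the identity holds for r = 0 as well (det Q₀ = 1 = F₁).
mainTheorem8 : (r : ℕ) → r ≥ 1 → det r (Q r) ≡ + fib (2 * r + 1)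
mainTheorem8 r _ = D≡fib r
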